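{- Let $G$ be an $n$-vertex graph, $M=\{v_1,\dots,v_k\}$ a clique modulator of $G$, $Q=V(G)\setminus M$, and $A_1,\dots,A_\ell$ the equivalence classes of $Q$. Let $\sigma_M$ be a permutation of $M$, and let $g_1:[\ell]\to\{A_1,\dots,A_\ell\}$ be a bijection with $\mathrm{rm}_{\sigma_M}(g_1(1),1)\ge \mathrm{rm}_{\sigma_M}(g_1(2),1)\ge\dots\ge \mathrm{rm}_{\sigma_M}(g_1(\ell),1)$. Let $\sigma$ be any ordering of $V(G)$ whose restriction to $M$ is $\sigma_M$, and let $Y$ be the set of vertices of $Q$ in block $1$ of $\sigma$ (so $Y=\sigma^{ -1}(\{1,\dots,|Y|\})$). Let $\widehat{\sigma}$ be an ordering of $V(G)$ that agrees with $\sigma$ on all positions greater than $|Y|$, and places $Y$ in positions $1,\dots,|Y|$ so that the vertices of $Y\cap g_1(1)$ come first (consecutively), followed by those of $Y\cap g_1(2)$, and so on up to $Y\cap g_1(\ell)$. Then $\mu_G(\widehat{\sigma})\le\mu_G(\sigma)$.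
   Context: All graphs are finite and simple. For an $n$-vertex graph $G$, an ordering is a bijection $\phi:V(G)\to[n]$; its cost is $\mu_G(\phi)=\sum_{\{u,v\}\in E(G)}\min\{\phi(u),\phi(v)\}$. A set $M\subset V(G)$ is a clique modulator if $G[V(G)\setminus M]$ is a clique. For $u\in Q=V(G)\setminus M$ let $N_M(u)=\{v\in M:\{u,v\}\in E(G)\}$; the equivalence classes of $Q$ are the classes of the relation $u\sim w$ iff $N_M(u)=N_M(w)$. The restriction $\sigma|_M$ of an ordering $\sigma$ is the bijection $M\to[|M|]$ preserving the relative order of $M$ in $\sigma$. For an ordering $\sigma$ with $\sigma|_M=\sigma_M$ and $i\in[k+1]$, block $i$ of $\sigma$ consists of the vertices of $Q$ placed after $\sigma_M^{ -1}(i-1)$ (no condition if $i=1$) and before $\sigma_M^{ -1}(i)$ (no condition if $i=k+1$). For $u\in Q$ and $i\in[k+1]$, the right modulator degree is $\mathrm{rm}_{\sigma_M}(u,i)=|\{v\in N_M(u):\sigma_M(v)\ge i\}|$; it is the same for all vertices of an equivalence class $A$, and is denoted $\mathrm{rm}_{\sigma_M}(A,i)$. -}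

module Defs where

open import Data.Nat using (ℕ; zero; suc; _+_; _<_; _≤_; _≥_; _⊔_; _⊓_)
open import Data.Nat.Properties using (_<?_)
open import Data.Bool using (Bool; true; false; if_then_else_; _∧_; not)
open import Data.Fin using (Fin; toℕ)
import Data.Fin as F
open import Data.Fin.Permutation using (Permutation′; _⟨$⟩ʳ_) public
open import Relation.Binary.PropositionalEquality using (_≡_; _≢_)
open import Relation.Nullary.Decidable using (⌊_⌋)

record Graph (n : ℕ) : Set where
  field
    adj   : Fin n → Fin n → Bool
    sym   : ∀ u v → adj u v ≡ adj v u
    irrefl : ∀ u → adj u u ≡ false
open Graph public

Σ[_] : ∀ {n} → (Fin n → ℕ) → ℕ
Σ[_] {zero}  f = 0
Σ[_] {suc n} f = f F.zero + Σ[ (λ i → f (F.suc i)) ]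

count : ∀ {n} → (Fin n → Bool) → ℕ
count p = Σ[ (λ i → if p i then 1 else 0) ]

allF : ∀ {n} → (Fin n → Bool) → Bool
allF {zero}  p = true
allF {suc n} p = p F.zero ∧ allF (λ i → p (F.suc i))

-- An ordering is a bijection V(G) → [n]; we use 0-based positions Fin n,
-- so the 1-based position of u is suc (toℕ (φ ⟨$⟩ʳ u)).
Ordering : ℕ → Set
Ordering n = Permutation′ n

pos : ∀ {n} → Ordering n → Fin n → ℕ
pos φ u = suc (toℕ (φ ⟨$⟩ʳ u))

cost : ∀ {n} → Graph n → Ordering n → ℕ
cost G φ = Σ[ (λ u → Σ[ (λ v →
  if ⌊ toℕ u <? toℕ v ⌋ ∧ adj G u v then pos φ u ⊓ pos φ v else 0) ]) ]

IsCliqueModulator : ∀ {n} → Graph n → (Fin n → Bool) → Set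
IsCliqueModulator G M =
  ∀ u v → M u ≡ false → M v ≡ false → u ≢ v → adj G u v ≡ true

SameClass : ∀ {n} → Graph n → (Fin n → Bool) → Fin n → Fin n → Set
SameClass G M u w = ∀ v → M v ≡ true → adj G u v ≡ adj G w v

-- σ_M(v) for v ∈ M: 1-based rank of v among the vertices of M in σ
rankM : ∀ {n} → (Fin n → Bool) → Ordering n → Fin n → ℕ
rankM M σ v = suc (count (λ w → M w ∧ ⌊ pos σ w <? pos σ v ⌋))

rm : ∀ {n} → Graph n → (Fin n → Bool) → Ordering n → Fin n → ℕ → ℕ
rm G M σ u i = count (λ v → M v ∧ adj G u v ∧ not ⌊ rankM M σ v <? i ⌋)

-- Y: vertices of Q in block 1 of σ (placed before every vertex of M)
block1 : ∀ {n} → (Fin n → Bool) → Ordering n → Fin n → Bool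
block1 M σ u = not (M u) ∧ allF (λ v → not (M v) ∨' ⌊ pos σ u <? pos σ v ⌋)
  where
  _∨'_ : Bool → Bool → Bool
  true  ∨' b = true
  false ∨' b = b

-- Count the cost twice, over ordered pairs of vertices.  Block 1, Y, is a clique
-- that occupies the first |Y| positions of both σ and σ̂, and the two orderings
-- agree off Y.  Hence pairs avoiding Y cost the same, pairs inside Y cost an amount
-- depending only on |Y|, and the pairs leaving Y contribute Σ_{u ∈ Y} e(u)·pos(u),
-- where e(u) = |Q ∖ Y| + |N_M(u)| counts the neighbours of u outside Y.  As σ̂
-- lists Y by decreasing e, a rearrangement inequality finishes the proof.  That
-- inequality follows by writing Σ_{u ∈ Y} e(u)·pos(u) as the sum of e(u) over the
-- pairs (u, w) with w at or before u: each unordered pair in Y then contributes the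
-- e-value of its later member, which σ̂ makes as small as possible.

module Submission where

open import Defs hiding (sym)
open import Data.Nat using (ℕ; zero; suc; _+_; _*_; _<_; _≤_; _>_; _⊓_; z≤n; s≤s; s<s; s<s⁻¹; s≤s⁻¹)
open import Data.Nat.Properties
open import Data.Bool using (Bool; true; false; if_then_else_; _∧_; _∨_; not)
import Data.Bool.Properties as B
open B using (∧-identityʳ; ¬-not)
open import Data.Fin using (Fin; toℕ)
import Data.Fin as F
import Data.Fin.Properties as FP
open import Data.Fin.Permutation using (_⟨$⟩ˡ_; inverseˡ; inverseʳ)
open import Data.Product using (Σ; _×_; _,_)
open import Data.Sum using (_⊎_; inj₁; inj₂)
open import Function using (_∘_; _⇔_; Equivalence)
open import Relation.Binary.PropositionalEquality
open import Relation.Binary.Definitions using (tri<; tri≈; tri>)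
open import Relation.Nullary using (Dec; yes; no; ¬_; contradiction)
open import Relation.Nullary.Decidable using (⌊_⌋; isYes≗does; dec-true; dec-false)
open import Algebra.Properties.Semiring.Sum +-*-semiring using (sum; ∑-distrib-+; sum-permute)

private
  variable
    n : ℕ

⌊⌋-true⇒ : ∀ {P : Set} (P? : Dec P) → ⌊ P? ⌋ ≡ true → P
⌊⌋-true⇒ (yes p) _ = p

module _ {P : Set} (P? : Dec P) where
  ⌊⌋-yes : P → ⌊ P? ⌋ ≡ true
  ⌊⌋-yes p = trans (isYes≗does P?) (dec-true P? p)

  ⌊⌋-no : ¬ P → ⌊ P? ⌋ ≡ false
  ⌊⌋-no ¬p = trans (isYes≗does P?) (dec-false P? ¬p)

m+m≤n+n⇒m≤n : ∀ {m n} → m + m ≤ n + n → m ≤ n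
m+m≤n+n⇒m≤n le = ≮⇒≥ λ n<m → <⇒≱ (+-mono-< n<m n<m) le

Σ≡sum : (f : Fin n → ℕ) → Σ[ f ] ≡ sum f
Σ≡sum {zero}  f = refl
Σ≡sum {suc n} f = cong (f F.zero +_) (Σ≡sum (f ∘ F.suc))

Σ-cong : {f g : Fin n → ℕ} → (∀ i → f i ≡ g i) → Σ[ f ] ≡ Σ[ g ]
Σ-cong {zero}  e = refl
Σ-cong {suc n} e = cong₂ _+_ (e F.zero) (Σ-cong (e ∘ F.suc))

Σ-mono : {f g : Fin n → ℕ} → (∀ i → f i ≤ g i) → Σ[ f ] ≤ Σ[ g ]
Σ-mono {zero}  le = z≤n
Σ-mono {suc n} le = +-mono-≤ (le F.zero) (Σ-mono (le ∘ F.suc))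

Σ-zero : Σ[ (λ (i : Fin n) → 0) ] ≡ 0
Σ-zero {zero}  = refl
Σ-zero {suc n} = Σ-zero {n}

Σ-+ : (f g : Fin n → ℕ) → Σ[ (λ i → f i + g i) ] ≡ Σ[ f ] + Σ[ g ]
Σ-+ f g = begin
  Σ[ (λ i → f i + g i) ]  ≡⟨ Σ≡sum (λ i → f i + g i) ⟩
  sum (λ i → f i + g i)   ≡⟨ ∑-distrib-+ f g ⟩
  sum f + sum g           ≡⟨ cong₂ _+_ (Σ≡sum f) (Σ≡sum g) ⟨
  Σ[ f ] + Σ[ g ]         ∎
  where open ≡-Reasoning

Σ-*ʳ : (f : Fin n → ℕ) (x : ℕ) → Σ[ f ] * x ≡ Σ[ (λ i → f i * x) ]
Σ-*ʳ {zero}  f x = refl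
Σ-*ʳ {suc n} f x = trans (*-distribʳ-+ x (f F.zero) _) (cong (f F.zero * x +_) (Σ-*ʳ (f ∘ F.suc) x))

Σ-comm : ∀ {m} (F : Fin m → Fin n → ℕ) → Σ[ (λ i → Σ[ F i ]) ] ≡ Σ[ (λ j → Σ[ (λ i → F i j) ]) ]
Σ-comm {n} {zero}  F = sym (Σ-zero {n})
Σ-comm {m = suc m} F = trans (cong (Σ[ F F.zero ] +_) (Σ-comm (F ∘ F.suc)))
                             (sym (Σ-+ (F F.zero) (λ j → Σ[ (λ i → F (F.suc i) j) ])))

Σ-permute : (π : Ordering n) (f : Fin n → ℕ) → Σ[ f ∘ (π ⟨$⟩ʳ_) ] ≡ Σ[ f ]
Σ-permute π f = trans (Σ≡sum (f ∘ (π ⟨$⟩ʳ_))) (trans (sym (sum-permute f π)) (sym (Σ≡sum f)))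

count-mono : {p q : Fin n → Bool} → (∀ i → p i ≡ true → q i ≡ true) → count p ≤ count q
count-mono imp = Σ-mono (λ i → indicator-mono (imp i))
  where
  indicator-mono : ∀ {a b} → (a ≡ true → b ≡ true) → (if a then 1 else 0) ≤ (if b then 1 else 0)
  indicator-mono {false} _ = z≤n
  indicator-mono {true}  imp rewrite imp refl = ≤-refl

count-* : (p : Fin n → Bool) (c : ℕ) → count p * c ≡ Σ[ (λ i → if p i then c else 0) ]
count-* {n} p c = trans (Σ-*ʳ {n} (λ i → if p i then 1 else 0) c) (Σ-cong (λ i → select (p i)))
  where
  select : ∀ b → (if b then 1 else 0) * c ≡ (if b then c else 0)
  select true  = +-identityʳ c
  select false = refl

count-toℕ< : ∀ {k} → k ≤ n → count (λ (i : Fin n) → ⌊ toℕ i <? k ⌋) ≡ k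
count-toℕ< {zero}  {zero}  _         = refl
count-toℕ< {suc n} {zero}  _         = count-toℕ< {n} z≤n
count-toℕ< {suc n} {suc k} (s≤s k≤n) =
  cong suc (trans (Σ-cong {n} (λ i → cong (λ b → if b then 1 else 0) (<?-suc (toℕ i) k))) (count-toℕ< k≤n))
  where
  <?-suc : ∀ a b → ⌊ suc a <? suc b ⌋ ≡ ⌊ a <? b ⌋
  <?-suc a b with a <? b
  ... | yes a<b = ⌊⌋-yes (suc a <? suc b) (s<s a<b)
  ... | no  a≮b = ⌊⌋-no (suc a <? suc b) (a≮b ∘ s<s⁻¹)

Σ²[_] : (Fin n → Fin n → ℕ) → ℕ
Σ²[ F ] = Σ[ (λ u → Σ[ F u ]) ]

Σ²-cong : {F H : Fin n → Fin n → ℕ} → (∀ u v → F u v ≡ H u v) → Σ²[ F ] ≡ Σ²[ H ]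
Σ²-cong e = Σ-cong (Σ-cong ∘ e)

Σ²-mono : {F H : Fin n → Fin n → ℕ} → (∀ u v → F u v ≤ H u v) → Σ²[ F ] ≤ Σ²[ H ]
Σ²-mono le = Σ-mono (Σ-mono ∘ le)

Σ²-+ : (F H : Fin n → Fin n → ℕ) → Σ²[ (λ u v → F u v + H u v) ] ≡ Σ²[ F ] + Σ²[ H ]
Σ²-+ F H = trans (Σ-cong (λ u → Σ-+ (F u) (H u))) (Σ-+ (λ u → Σ[ F u ]) (λ u → Σ[ H u ]))

Σ²-symmetrize : (F : Fin n → Fin n → ℕ) → Σ²[ F ] + Σ²[ F ] ≡ Σ²[ (λ u v → F u v + F v u) ]
Σ²-symmetrize F = trans (cong (Σ²[ F ] +_) (Σ-comm F)) (sym (Σ²-+ F (λ u v → F v u)))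

Σ²-mono-symmetric : {F H : Fin n → Fin n → ℕ} →
  (∀ u v → F u v + F v u ≤ H u v + H v u) → Σ²[ F ] ≤ Σ²[ H ]
Σ²-mono-symmetric {F = F} {H} le =
  m+m≤n+n⇒m≤n (subst₂ _≤_ (sym (Σ²-symmetrize F)) (sym (Σ²-symmetrize H)) (Σ²-mono le))

Σ²-permute : (π : Ordering n) (F : Fin n → Fin n → ℕ) →
  Σ²[ (λ u v → F (π ⟨$⟩ʳ u) (π ⟨$⟩ʳ v)) ] ≡ Σ²[ F ]
Σ²-permute π F = trans (Σ-cong (λ u → Σ-permute π (F (π ⟨$⟩ʳ u)))) (Σ-permute π (λ i → Σ[ F i ]))

index : Ordering n → Fin n → ℕ
index φ u = toℕ (φ ⟨$⟩ʳ u)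

index-injective : (φ : Ordering n) {u v : Fin n} → index φ u ≡ index φ v → u ≡ v
index-injective φ e = trans (sym (inverseˡ φ)) (trans (cong (φ ⟨$⟩ˡ_) (FP.toℕ-injective e)) (inverseˡ φ))

count-index< : (φ : Ordering n) {k : ℕ} → k ≤ n → count (λ u → ⌊ index φ u <? k ⌋) ≡ k
count-index< φ {k} k≤n = trans (Σ-permute φ (λ i → if ⌊ toℕ i <? k ⌋ then 1 else 0)) (count-toℕ< k≤n)

Precedes : (Fin n → Bool) → Ordering n → Set
Precedes Y φ = ∀ {u w} → Y u ≡ true → Y w ≡ false → index φ u < index φ w

record Prefix (Y : Fin n → Bool) (φ : Ordering n) : Set where
  field
    index<  : ∀ {u} → Y u ≡ true → index φ u < count Y
    index≥  : ∀ {u} → Y u ≡ false → count Y ≤ index φ u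

  membership : ∀ u → Y u ≡ ⌊ index φ u <? count Y ⌋
  membership u with Y u in yu
  ... | true  = sym (⌊⌋-yes (index φ u <? count Y) (index< yu))
  ... | false = sym (⌊⌋-no (index φ u <? count Y) (≤⇒≯ (index≥ yu)))

open Prefix

prefix⇒precedes : {Y : Fin n → Bool} {φ : Ordering n} → Prefix Y φ → Precedes Y φ
prefix⇒precedes p yu yw = <-≤-trans (index< p yu) (index≥ p yw)

precedes⇒prefix : {Y : Fin n → Bool} {φ : Ordering n} → Precedes Y φ → Prefix Y φ
precedes⇒prefix {Y = Y} {φ} prec = record { index< = before ; index≥ = after }
  where
  before : ∀ {u} → Y u ≡ true → index φ u < count Y
  before {u} yu = subst (_≤ count Y) (count-index< φ (FP.toℕ<n (φ ⟨$⟩ʳ u)))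
    (count-mono λ w w≤u → ¬-not λ yw →
      <⇒≱ (prec yu yw) (s≤s⁻¹ (⌊⌋-true⇒ (index φ w <? suc (index φ u)) w≤u)))

  after : ∀ {u} → Y u ≡ false → count Y ≤ index φ u
  after {u} yu = subst (count Y ≤_) (count-index< φ (<⇒≤ (FP.toℕ<n (φ ⟨$⟩ʳ u))))
    (count-mono λ w yw → ⌊⌋-yes (index φ w <? index φ u) (prec yw yu))

prefix-transfer : {Y : Fin n → Bool} {φ ψ : Ordering n} → Prefix Y φ →
  (∀ u → pos φ u > count Y → pos ψ u ≡ pos φ u) → Prefix Y ψ
prefix-transfer {Y = Y} {φ} {ψ} p agree = record { index< = before ; index≥ = after }
  where
  index-agree : ∀ {u} → count Y ≤ index φ u → index ψ u ≡ index φ u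
  index-agree le = suc-injective (agree _ (s≤s le))

  after : ∀ {u} → Y u ≡ false → count Y ≤ index ψ u
  after yu = subst (count Y ≤_) (sym (index-agree (index≥ p yu))) (index≥ p yu)

  -- the vertex that φ puts where ψ puts u is itself placed there by ψ, hence is u
  before : ∀ {u} → Y u ≡ true → index ψ u < count Y
  before {u} yu = ≰⇒> λ Y≤ψu →
    let φv≡ψu = cong toℕ (inverseʳ φ)
        Y≤φv  = subst (count Y ≤_) (sym φv≡ψu) Y≤ψu
        v≡u   = index-injective ψ (trans (index-agree Y≤φv) φv≡ψu)
    in <⇒≱ (index< p yu) (subst (λ x → count Y ≤ index φ x) v≡u Y≤φv)

Σ²-over-prefix : {Y : Fin n → Bool} {φ : Ordering n} → Prefix Y φ → (F : ℕ → ℕ → ℕ) →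
  Σ²[ (λ u v → if Y u ∧ Y v then F (index φ u) (index φ v) else 0) ] ≡
  Σ²[ (λ (i j : Fin n) → if ⌊ toℕ i <? count Y ⌋ ∧ ⌊ toℕ j <? count Y ⌋ then F (toℕ i) (toℕ j) else 0) ]
Σ²-over-prefix {Y = Y} {φ} p F = trans
  (Σ²-cong λ u v → cong₂ (λ a b → if a ∧ b then F (index φ u) (index φ v) else 0) (membership p u) (membership p v))
  (Σ²-permute φ (λ i j → if ⌊ toℕ i <? count Y ⌋ ∧ ⌊ toℕ j <? count Y ⌋ then F (toℕ i) (toℕ j) else 0))

module _ {n} (Y : Fin n → Bool) (d : Fin n → ℕ) where

  weightedPos : Ordering n → ℕ
  weightedPos φ = Σ[ (λ u → if Y u then d u * pos φ u else 0) ]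

  private
    laterWeight : Ordering n → Fin n → Fin n → ℕ
    laterWeight φ u w = if Y u ∧ ⌊ index φ w <? pos φ u ⌋ then d u else 0

    laterWeight-∈ : ∀ φ {u w} → Y u ≡ true →
      laterWeight φ u w ≡ (if ⌊ index φ w <? pos φ u ⌋ then d u else 0)
    laterWeight-∈ φ {u} {w} yu = cong (λ b → if b ∧ ⌊ index φ w <? pos φ u ⌋ then d u else 0) yu

    laterWeight-∉ : ∀ φ {u w} → Y u ≡ false → laterWeight φ u w ≡ 0
    laterWeight-∉ φ {u} {w} yu = cong (λ b → if b ∧ ⌊ index φ w <? pos φ u ⌋ then d u else 0) yu

    laterWeight-diagonal : ∀ φ u → laterWeight φ u u ≡ (if Y u then d u else 0)
    laterWeight-diagonal φ u = trans
      (cong (λ b → if Y u ∧ b then d u else 0) (⌊⌋-yes (index φ u <? pos φ u) ≤-refl))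
      (cong (λ b → if b then d u else 0) (∧-identityʳ (Y u)))

    laterWeight-precedes : ∀ ψ {u w} → Precedes Y ψ → Y w ≡ false → laterWeight ψ u w ≡ 0
    laterWeight-precedes ψ {u} {w} prec yw with Y u in yu
    ... | false = refl
    ... | true  = cong (λ b → if b then d u else 0) (⌊⌋-no (index ψ w <? pos ψ u) (<⇒≱ (prec yu yw) ∘ s≤s⁻¹))

    laterWeight-pair : ∀ φ {u w} → u ≢ w → Y u ≡ true → Y w ≡ true →
      (index φ w < index φ u × laterWeight φ u w + laterWeight φ w u ≡ d u) ⊎
      (index φ u < index φ w × laterWeight φ u w + laterWeight φ w u ≡ d w)
    laterWeight-pair φ {u} {w} u≢w yu yw
      rewrite laterWeight-∈ φ {u} {w} yu | laterWeight-∈ φ {w} {u} yw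
      with index φ w <? pos φ u | index φ u <? pos φ w
    ... | yes w≤u | yes u≤w = contradiction (index-injective φ (≤-antisym (s≤s⁻¹ u≤w) (s≤s⁻¹ w≤u))) u≢w
    ... | yes w≤u | no  _   = inj₁ (≤∧≢⇒< (s≤s⁻¹ w≤u) (u≢w ∘ sym ∘ index-injective φ) , +-identityʳ (d u))
    ... | no  _   | yes u≤w = inj₂ (≤∧≢⇒< (s≤s⁻¹ u≤w) (u≢w ∘ index-injective φ) , refl)
    ... | no  w≰u | no  u≰w = contradiction (≮⇒≥ w≰u) (<-asym (≮⇒≥ u≰w))

    laterWeight-pair-≥ : ∀ φ {u w} → u ≢ w → Y u ≡ true → Y w ≡ true →
      d u ⊓ d w ≤ laterWeight φ u w + laterWeight φ w u
    laterWeight-pair-≥ φ {u} {w} u≢w yu yw with laterWeight-pair φ u≢w yu yw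
    ... | inj₁ (_ , e) = subst (d u ⊓ d w ≤_) (sym e) (m⊓n≤m (d u) (d w))
    ... | inj₂ (_ , e) = subst (d u ⊓ d w ≤_) (sym e) (m⊓n≤n (d u) (d w))

    weightedPos≡Σ² : ∀ φ → weightedPos φ ≡ Σ²[ laterWeight φ ]
    weightedPos≡Σ² φ = Σ-cong row
      where
      row : ∀ u → (if Y u then d u * pos φ u else 0) ≡ Σ[ laterWeight φ u ]
      row u with Y u in yu
      ... | false = sym (Σ-zero {n})
      ... | true  = begin
        d u * pos φ u                                      ≡⟨ *-comm (d u) (pos φ u) ⟩
        pos φ u * d u                                      ≡⟨ cong (_* d u) (count-index< φ (FP.toℕ<n (φ ⟨$⟩ʳ u))) ⟨
        count (λ w → ⌊ index φ w <? pos φ u ⌋) * d u       ≡⟨ count-* (λ w → ⌊ index φ w <? pos φ u ⌋) (d u) ⟩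
        Σ[ (λ w → if ⌊ index φ w <? pos φ u ⌋ then d u else 0) ] ∎
        where open ≡-Reasoning

  weightedPos-minimal : ∀ φ ψ → Precedes Y ψ →
    (∀ {u w} → Y u ≡ true → Y w ≡ true → index ψ w < index ψ u → d u ≤ d w) →
    weightedPos ψ ≤ weightedPos φ
  weightedPos-minimal φ ψ prec sorted =
    subst₂ _≤_ (sym (weightedPos≡Σ² ψ)) (sym (weightedPos≡Σ² φ)) (Σ²-mono-symmetric pair)
    where
    pair : ∀ u w → laterWeight ψ u w + laterWeight ψ w u ≤ laterWeight φ u w + laterWeight φ w u
    pair u w with u F.≟ w
    ... | yes refl = ≤-reflexive (cong₂ _+_ diagonal diagonal)
      where diagonal = trans (laterWeight-diagonal ψ u) (sym (laterWeight-diagonal φ u))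
    ... | no u≢w with Y u B.≟ true | Y w B.≟ true
    ...   | no yu≢ | _ = ≤-trans (≤-reflexive (cong₂ _+_ (laterWeight-∉ ψ {u} {w} yu) (laterWeight-precedes ψ {w} prec yu))) z≤n
      where yu = ¬-not yu≢
    ...   | yes _ | no yw≢ = ≤-trans (≤-reflexive (cong₂ _+_ (laterWeight-precedes ψ {u} prec yw) (laterWeight-∉ ψ {w} {u} yw))) z≤n
      where yw = ¬-not yw≢
    ...   | yes yu | yes yw = ≤-trans later≤min (laterWeight-pair-≥ φ u≢w yu yw)
      where
      later≤min : laterWeight ψ u w + laterWeight ψ w u ≤ d u ⊓ d w
      later≤min with laterWeight-pair ψ u≢w yu yw
      ... | inj₁ (w<u , e) = ≤-trans (≤-reflexive e) (⊓-glb ≤-refl (sorted yu yw w<u))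
      ... | inj₂ (u<w , e) = ≤-trans (≤-reflexive e) (⊓-glb (sorted yw yu u<w) ≤-refl)

IsClique : Graph n → (Fin n → Bool) → Set
IsClique G Y = ∀ {u v} → Y u ≡ true → Y v ≡ true → u ≢ v → adj G u v ≡ true

module _ {n} (G : Graph n) where

  edgeCost : Ordering n → Fin n → Fin n → ℕ
  edgeCost φ u v = if adj G u v then pos φ u ⊓ pos φ v else 0

  cost-double : ∀ φ → cost G φ + cost G φ ≡ Σ²[ edgeCost φ ]
  cost-double φ = trans (Σ²-symmetrize oriented) (Σ²-cong both-orientations)
    where
    oriented : Fin n → Fin n → ℕ
    oriented u v = if ⌊ toℕ u <? toℕ v ⌋ ∧ adj G u v then pos φ u ⊓ pos φ v else 0

    both-orientations : ∀ u v → oriented u v + oriented v u ≡ edgeCost φ u v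
    both-orientations u v with toℕ u <? toℕ v | toℕ v <? toℕ u
    ... | yes u<v | yes v<u = contradiction u<v (<-asym v<u)
    ... | yes _   | no  _   = +-identityʳ _
    ... | no  _   | yes _ rewrite Graph.sym G v u with adj G u v
    ...   | true  = ⊓-comm (pos φ v) (pos φ u)
    ...   | false = refl
    both-orientations u v | no u≮v | no v≮u with FP.toℕ-injective (≤-antisym (≮⇒≥ v≮u) (≮⇒≥ u≮v))
    ... | refl rewrite Graph.irrefl G u = refl

module _ {n} (G : Graph n) (Y : Fin n → Bool) where

  outerCost innerCost exitCost : Ordering n → Fin n → Fin n → ℕ
  outerCost φ u v = if Y u ∨ Y v then 0 else edgeCost G φ u v
  innerCost φ u v = if Y u ∧ Y v then edgeCost G φ u v else 0
  exitCost  φ u v = if Y u then (if not (Y v) ∧ adj G u v then pos φ u else 0) else 0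

  exitDegree : Fin n → ℕ
  exitDegree u = count (λ v → not (Y v) ∧ adj G u v)

  edgeCost-split : ∀ φ → Precedes Y φ → ∀ u v →
    edgeCost G φ u v ≡ outerCost φ u v + (innerCost φ u v + (exitCost φ u v + exitCost φ v u))
  edgeCost-split φ prec u v with Y u in yu | Y v in yv
  ... | true  | true  = sym (+-identityʳ _)
  ... | false | false = sym (+-identityʳ _)
  ... | true  | false with adj G u v
  ...   | true  = trans (m≤n⇒m⊓n≡m (<⇒≤ (s<s (prec yu yv)))) (sym (+-identityʳ _))
  ...   | false = refl
  edgeCost-split φ prec u v | false | true rewrite Graph.sym G v u with adj G u v
  ...   | true  = m≥n⇒m⊓n≡n (<⇒≤ (s<s (prec yv yu)))
  ...   | false = refl

  Σ²-exitCost : ∀ φ → Σ²[ exitCost φ ] ≡ weightedPos Y exitDegree φ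
  Σ²-exitCost φ = Σ-cong row
    where
    row : ∀ u → Σ[ exitCost φ u ] ≡ (if Y u then exitDegree u * pos φ u else 0)
    row u with Y u
    ... | false = Σ-zero {n}
    ... | true  = sym (count-* (λ v → not (Y v) ∧ adj G u v) (pos φ u))

  cost-decomposition : ∀ φ → Precedes Y φ →
    cost G φ + cost G φ ≡
    Σ²[ outerCost φ ] + (Σ²[ innerCost φ ] + (weightedPos Y exitDegree φ + weightedPos Y exitDegree φ))
  cost-decomposition φ prec = begin
    cost G φ + cost G φ
      ≡⟨ cost-double G φ ⟩
    Σ²[ edgeCost G φ ]
      ≡⟨ Σ²-cong (edgeCost-split φ prec) ⟩
    Σ²[ (λ u v → outerCost φ u v + (innerCost φ u v + (exitCost φ u v + exitCost φ v u))) ]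
      ≡⟨ Σ²-+ (outerCost φ) _ ⟩
    Σ²[ outerCost φ ] + Σ²[ (λ u v → innerCost φ u v + (exitCost φ u v + exitCost φ v u)) ]
      ≡⟨ cong (Σ²[ outerCost φ ] +_) (Σ²-+ (innerCost φ) _) ⟩
    Σ²[ outerCost φ ] + (Σ²[ innerCost φ ] + Σ²[ (λ u v → exitCost φ u v + exitCost φ v u) ])
      ≡⟨ cong (λ x → Σ²[ outerCost φ ] + (Σ²[ innerCost φ ] + x)) (Σ²-symmetrize (exitCost φ)) ⟨
    Σ²[ outerCost φ ] + (Σ²[ innerCost φ ] + (Σ²[ exitCost φ ] + Σ²[ exitCost φ ]))
      ≡⟨ cong (λ x → Σ²[ outerCost φ ] + (Σ²[ innerCost φ ] + (x + x))) (Σ²-exitCost φ) ⟩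
    Σ²[ outerCost φ ] + (Σ²[ innerCost φ ] + (weightedPos Y exitDegree φ + weightedPos Y exitDegree φ)) ∎
    where open ≡-Reasoning

  Σ²-outerCost-cong : ∀ φ ψ → (∀ {u} → Y u ≡ false → pos ψ u ≡ pos φ u) →
    Σ²[ outerCost ψ ] ≡ Σ²[ outerCost φ ]
  Σ²-outerCost-cong φ ψ agree = Σ²-cong pointwise
    where
    pointwise : ∀ u v → outerCost ψ u v ≡ outerCost φ u v
    pointwise u v with Y u in yu | Y v in yv
    ... | true  | _     = refl
    ... | false | true  = refl
    ... | false | false = cong (λ x → if adj G u v then x else 0) (cong₂ _⊓_ (agree yu) (agree yv))

  distinctMin : ℕ → ℕ → ℕ
  distinctMin i j = if ⌊ i ≟ j ⌋ then 0 else suc i ⊓ suc j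

  innerCost-positional : IsClique G Y → ∀ φ u v →
    innerCost φ u v ≡ (if Y u ∧ Y v then distinctMin (index φ u) (index φ v) else 0)
  innerCost-positional clique φ u v with Y u in yu | Y v in yv
  ... | false | _     = refl
  ... | true  | false = refl
  ... | true  | true  with u F.≟ v
  ...   | yes refl rewrite Graph.irrefl G u | ⌊⌋-yes (index φ u ≟ index φ u) refl = refl
  ...   | no  u≢v  rewrite clique yu yv u≢v | ⌊⌋-no (index φ u ≟ index φ v) (u≢v ∘ index-injective φ) = refl

  Σ²-innerCost-invariant : IsClique G Y → ∀ {φ ψ} → Prefix Y φ → Prefix Y ψ →
    Σ²[ innerCost ψ ] ≡ Σ²[ innerCost φ ]
  Σ²-innerCost-invariant clique pφ pψ = trans (on-prefix pψ) (sym (on-prefix pφ))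
    where
    on-prefix : ∀ {χ} → Prefix Y χ → Σ²[ innerCost χ ] ≡
      Σ²[ (λ (i j : Fin n) → if ⌊ toℕ i <? count Y ⌋ ∧ ⌊ toℕ j <? count Y ⌋ then distinctMin (toℕ i) (toℕ j) else 0) ]
    on-prefix {χ} p = trans (Σ²-cong (innerCost-positional clique χ)) (Σ²-over-prefix p distinctMin)

  cost-≤-within-clique-prefix : IsClique G Y → ∀ {φ ψ} → Prefix Y φ → Prefix Y ψ →
    (∀ {u} → Y u ≡ false → pos ψ u ≡ pos φ u) →
    weightedPos Y exitDegree ψ ≤ weightedPos Y exitDegree φ →
    cost G ψ ≤ cost G φ
  cost-≤-within-clique-prefix clique {φ} {ψ} pφ pψ agree exit≤ = m+m≤n+n⇒m≤n (begin
    cost G ψ + cost G ψ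
      ≡⟨ cost-decomposition ψ (prefix⇒precedes pψ) ⟩
    Σ²[ outerCost ψ ] + (Σ²[ innerCost ψ ] + (weightedPos Y exitDegree ψ + weightedPos Y exitDegree ψ))
      ≤⟨ +-mono-≤ (≤-reflexive (Σ²-outerCost-cong φ ψ agree))
           (+-mono-≤ (≤-reflexive (Σ²-innerCost-invariant clique pφ pψ)) (+-mono-≤ exit≤ exit≤)) ⟩
    Σ²[ outerCost φ ] + (Σ²[ innerCost φ ] + (weightedPos Y exitDegree φ + weightedPos Y exitDegree φ))
      ≡⟨ cost-decomposition φ (prefix⇒precedes pφ) ⟨
    cost G φ + cost G φ ∎)
    where open ≤-Reasoning

allF-true : {p : Fin n → Bool} → allF p ≡ true → ∀ i → p i ≡ true
allF-true {suc n} {p} e i with p F.zero in p0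
allF-true {suc n} {p} e F.zero    | true = p0
allF-true {suc n} {p} e (F.suc i) | true = allF-true {p = p ∘ F.suc} e i

allF-false : {p : Fin n → Bool} → allF p ≡ false → Σ (Fin n) (λ i → p i ≡ false)
allF-false {suc n} {p} e with p F.zero in p0
... | false = F.zero , p0
... | true  with allF-false {p = p ∘ F.suc} e
...   | i , pi = F.suc i , pi

modulatorDegree : Graph n → (Fin n → Bool) → Fin n → ℕ
modulatorDegree G M u = count (λ v → M v ∧ adj G u v)

rm-at-1 : (G : Graph n) (M : Fin n → Bool) (σ : Ordering n) (u : Fin n) →
  rm G M σ u 1 ≡ modulatorDegree G M u
rm-at-1 G M σ u = Σ-cong λ v → cong (λ b → if M v ∧ b then 1 else 0) (∧-identityʳ (adj G u v))

modulatorDegree-cong : (G : Graph n) (M : Fin n → Bool) {u w : Fin n} →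
  SameClass G M u w → modulatorDegree G M u ≡ modulatorDegree G M w
modulatorDegree-cong G M {u} {w} same = Σ-cong pointwise
  where
  pointwise : ∀ v → (if M v ∧ adj G u v then 1 else 0) ≡ (if M v ∧ adj G w v then 1 else 0)
  pointwise v with M v in mv
  ... | true  = cong (λ b → if b then 1 else 0) (same v mv)
  ... | false = refl

exitDegree-split : (G : Graph n) (M : Fin n → Bool) (Y : Fin n → Bool) →
  IsCliqueModulator G M → (∀ {u} → Y u ≡ true → M u ≡ false) → ∀ {u} → Y u ≡ true →
  exitDegree G Y u ≡ count (λ v → not (Y v) ∧ not (M v)) + modulatorDegree G M u
exitDegree-split G M Y cm Y⊆Q {u} yu =
  trans (Σ-cong pointwise) (Σ-+ (λ v → if not (Y v) ∧ not (M v) then 1 else 0) (λ v → if M v ∧ adj G u v then 1 else 0))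
  where
  pointwise : ∀ v → (if not (Y v) ∧ adj G u v then 1 else 0) ≡
    (if not (Y v) ∧ not (M v) then 1 else 0) + (if M v ∧ adj G u v then 1 else 0)
  pointwise v with Y v in yv | M v in mv
  ... | true  | true  = contradiction (trans (sym mv) (Y⊆Q yv)) λ ()
  ... | true  | false = refl
  ... | false | true  = refl
  ... | false | false rewrite cm u v (Y⊆Q yu) mv (λ { refl → contradiction (trans (sym yu) yv) λ () }) = refl

module _ {n} (M : Fin n → Bool) (σ : Ordering n) where

  block1⊆Q : ∀ {u} → block1 M σ u ≡ true → M u ≡ false
  block1⊆Q {u} yu with M u
  ... | false = refl
  block1⊆Q () | true

  block1-precedes-modulator : ∀ {u v} → block1 M σ u ≡ true → M v ≡ true → index σ u < index σ v
  block1-precedes-modulator {u} {v} yu mv with M u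
  ... | false with M v | mv | allF-true yu v
  ...   | true | refl | u<v = s<s⁻¹ (⌊⌋-true⇒ (pos σ u <? pos σ v) u<v)
  block1-precedes-modulator () _ | true

  modulator-before : ∀ {w} → M w ≡ false → block1 M σ w ≡ false →
    Σ (Fin n) (λ x → M x ≡ true × index σ x < index σ w)
  modulator-before {w} mw yw with M w in mw′
  ... | false with allF-false yw
  ...   | x , px with M x in mx | px
  ...     | false | ()
  ...     | true  | w≮x = x , mx , ≤∧≢⇒< (s≤s⁻¹ (≮⇒≥ w≮x′)) x≢w
    where
    w≮x′ : ¬ pos σ w < pos σ x
    w≮x′ w<x = contradiction (trans (sym (⌊⌋-yes (pos σ w <? pos σ x) w<x)) w≮x) λ ()
    x≢w : index σ x ≢ index σ w
    x≢w e = contradiction (trans (trans (sym mx) (cong M (index-injective σ e))) mw′) λ ()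

  block1-precedes : Precedes (block1 M σ) σ
  block1-precedes {u} {w} yu yw with M w B.≟ true
  ... | yes mw = block1-precedes-modulator yu mw
  ... | no  mw with modulator-before (¬-not mw) yw
  ...   | x , mx , x<w = <-trans (block1-precedes-modulator yu mx) x<w

lemma5 : ∀ {n ℓ : ℕ} (G : Graph n) (M : Fin n → Bool) →
    IsCliqueModulator G M →
    (σ : Ordering n) →
    (h : Fin n → Fin ℓ) →
    (∀ u w → M u ≡ false → M w ≡ false → (h u ≡ h w ⇔ SameClass G M u w)) →
    (∀ j → Σ (Fin n) (λ u → (M u ≡ false) × (h u ≡ j))) →
    (∀ u w → M u ≡ false → M w ≡ false → toℕ (h u) < toℕ (h w) →
      rm G M σ w 1 ≤ rm G M σ u 1) →
    (σ̂ : Ordering n) →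
    (∀ u → pos σ u > count (block1 M σ) → pos σ̂ u ≡ pos σ u) →
    (∀ u w → block1 M σ u ≡ true → block1 M σ w ≡ true →
      toℕ (h u) < toℕ (h w) → pos σ̂ u < pos σ̂ w) →
    cost G σ̂ ≤ cost G σ
lemma5 G M cm σ h classes _ rm-sorted σ̂ agree grouped =
  cost-≤-within-clique-prefix G Y Y-clique prefixσ prefixσ̂ (λ yu → agree _ (s≤s (index≥ prefixσ yu)))
    (weightedPos-minimal Y (exitDegree G Y) σ σ̂ (prefix⇒precedes prefixσ̂) exitDegree-sorted)
  where
  Y = block1 M σ

  prefixσ : Prefix Y σ
  prefixσ = precedes⇒prefix (block1-precedes M σ)

  prefixσ̂ : Prefix Y σ̂
  prefixσ̂ = prefix-transfer prefixσ agree

  Y-clique : IsClique G Y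
  Y-clique yu yv = cm _ _ (block1⊆Q M σ yu) (block1⊆Q M σ yv)

  modulatorDegree-sorted : ∀ {u w} → Y u ≡ true → Y w ≡ true → index σ̂ w < index σ̂ u →
    modulatorDegree G M u ≤ modulatorDegree G M w
  modulatorDegree-sorted {u} {w} yu yw w<u with <-cmp (toℕ (h u)) (toℕ (h w))
  ... | tri< hu<hw _ _ = contradiction (grouped u w yu yw hu<hw) (<-asym (s<s w<u))
  ... | tri≈ _ hu≡hw _ = ≤-reflexive (modulatorDegree-cong G M
          (Equivalence.to (classes u w (block1⊆Q M σ yu) (block1⊆Q M σ yw)) (FP.toℕ-injective hu≡hw)))
  ... | tri> _ _ hw<hu = subst₂ _≤_ (rm-at-1 G M σ u) (rm-at-1 G M σ w)
          (rm-sorted w u (block1⊆Q M σ yw) (block1⊆Q M σ yu) hw<hu)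

  exitDegree-sorted : ∀ {u w} → Y u ≡ true → Y w ≡ true → index σ̂ w < index σ̂ u →
    exitDegree G Y u ≤ exitDegree G Y w
  exitDegree-sorted yu yw w<u =
    subst₂ _≤_ (sym (exitDegree-split G M Y cm (block1⊆Q M σ) yu)) (sym (exitDegree-split G M Y cm (block1⊆Q M σ) yw))
      (+-monoʳ-≤ _ (modulatorDegree-sorted yu yw w<u))
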